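{- Let $G$ be a 2-connected outerplanar near-triangulation with $V(G)=\{u,v_1,\dots,v_k\}$, $k>3$, $N_G(u)=\{v_1,\dots,v_k\}$ and $\deg_G(v_1)=\deg_G(v_k)=2$, with $v_1,\dots,v_k$ labelled consecutively along the path $G-u$. Then $P(G)$ contains a non-vanishing monomial $\eta\,u^3v_1^1v_2^1v_k^0\prod_{i=3}^{k-1}v_i^2$.
   Context: For a graph $G$, vertices are also variables and $P(G)=\prod_{xy\in E(G),\,x<y}(x-y)$ for a fixed arbitrary orientation; a monomial is non-vanishing if its coefficient is nonzero. A 2-connected outerplanar near-triangulation is a 2-connected outerplanar graph embedded with all vertices on the outer cycle and all bounded faces triangles. -}

module Defs where

open import Data.Nat as ℕ using (ℕ; zero; suc; _∸_; _<_)
open import Data.Fin as Fin using (Fin; toℕ)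
open import Data.Integer as ℤ using (ℤ; 0ℤ; 1ℤ; _-_)
open import Data.List using (List; []; _∷_; concatMap; map; allFin)
open import Data.Nat.ListAction using (sum)
open import Data.Bool using (Bool; true; false; if_then_else_)
open import Data.Product using (_×_; _,_)
open import Relation.Nullary using (does)
open import Relation.Binary.PropositionalEquality using (_≡_)

-- A finite simple graph on vertex set Fin n (vertices double as variables).
record Graph (n : ℕ) : Set where
  field
    adj   : Fin n → Fin n → Bool
    sym   : ∀ x y → adj x y ≡ adj y x
    irref : ∀ x → adj x x ≡ false
open Graph public

-- Edges xy with x < y (the fixed orientation: factor (x - y)).
edges : ∀ {n} → Graph n → List (Fin n × Fin n)
edges {n} G =
  concatMap (λ x → concatMap (λ y →
      if does (toℕ x ℕ.<? toℕ y) then (if adj G x y then (x , y) ∷ [] else []) else [])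
    (allFin n)) (allFin n)

Monomial : ℕ → Set
Monomial n = Fin n → ℕ

degree : ∀ {n} → Monomial n → ℕ
degree {n} e = sum (map e (allFin n))

lower : ∀ {n} → Monomial n → Fin n → Monomial n
lower e a i = if does (i Fin.≟ a) then e i ∸ 1 else e i

-- Coefficient of the monomial e in the product  ∏_{(a,b) ∈ es} (x_a - x_b),
-- computed by literally expanding the product factor by factor.
coeffProd : ∀ {n} → List (Fin n × Fin n) → Monomial n → ℤ
coeffProd [] e = if does (degree e ℕ.≟ 0) then 1ℤ else 0ℤ
coeffProd ((a , b) ∷ es) e = pick a - pick b
  where
  pick : _ → ℤ
  pick x with e x
  ... | zero  = 0ℤ
  ... | suc _ = coeffProd es (lower e x)

coeffP : ∀ {n} → Graph n → Monomial n → ℤ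
coeffP G e = coeffProd (edges G) e

-- Vertices: u = Fin.zero, v_i = Fin.suc j with toℕ j = i - 1  (i = 1..k).
-- Exponents of the target monomial u^3 v_1^1 v_2^1 v_k^0 ∏_{i=3}^{k-1} v_i^2.
vexp : ℕ → ℕ → ℕ
vexp k 0 = 1
vexp k 1 = 1
vexp k (suc (suc m)) = if does (ℕ._≟_ (suc (suc (suc m))) k) then 0 else 2

targetMonomial : (k : ℕ) → Monomial (suc k)
targetMonomial k Fin.zero = 3
targetMonomial k (Fin.suc j) = vexp k (toℕ j)

{-# OPTIONS --safe #-}
-- Order the 2k − 1 factors of P(G) so that the two factors u v_{m+2} and v_{m+1} v_{m+2} at the
-- newest path vertex come first. As v_{m+2} occurs in no other factor, its exponent must be spent
-- on these two, which gives a recursion for the coefficient c_m(a, c) of u^a v₁ v₂ v₃² ⋯ v_m² v_{m+1}^c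
-- in the fan on u, v₁, …, v_{m+1} (with p_m the exponent of v_{m+1} in the target):
--   c_{m+1}(a, 0) = c_m(a − 1, p_m − 1),
--   c_{m+1}(a, 1) = − c_m(a − 1, p_m) − c_m(a, p_m − 1),
--   c_{m+1}(a, 2) = c_m(a, p_m).
-- From c₁(1, 1) = 0 it follows that c_m(1, 2) = 0 and c_m(2, 1) = ± 1 for all m ≥ 2, and the target
-- coefficient is c_{k−1}(3, 0) = c_{k−2}(2, 1).
module Submission where

open import Defs hiding (sym)
open import Data.Nat as ℕ using (ℕ; zero; suc; _∸_; _<_; _≤_; z≤n; s≤s)
import Data.Nat.Properties as ℕₚ
import Data.Fin.Properties as Finₚ
open import Data.Fin as Fin using (Fin; zero; suc; toℕ)
open import Data.Integer as ℤ using (ℤ; 0ℤ; 1ℤ; -1ℤ; _-_; -_)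
import Data.Integer.Properties as ℤₚ
open import Data.Integer.Tactic.RingSolver using (solve-∀)
open import Data.List using (List; []; _∷_; _++_; _∷ʳ_; allFin; map; concat; concatMap; tabulate; applyUpTo)
import Data.List.Properties as Listₚ
import Data.List.Relation.Binary.Permutation.Propositional.Properties as ↭ₚ
open import Data.List.Relation.Binary.Permutation.Propositional as ↭ using (_↭_)
open import Data.List.Relation.Unary.All using (All; []; _∷_)
open import Data.List.Relation.Unary.Any using (here; there)
open import Data.List.Membership.Propositional using (_∈_)
open import Data.List.Membership.Propositional.Properties using (∈-allFin)
open import Data.Nat.ListAction using (sum)
open import Data.Bool using (Bool; true; false; if_then_else_)
open import Data.Product using (_×_; _,_)
open import Data.Sum using (_⊎_; inj₁; inj₂)
open import Function.Bundles using (_⇔_; Equivalence)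
open import Data.Empty using (⊥-elim)
open import Function using (_∘_; case_of_)
open import Relation.Nullary using (Dec; does; yes; no)
open import Relation.Nullary.Decidable using (dec-true; dec-false; _⊎-dec_)
open import Relation.Binary.PropositionalEquality
open ≡-Reasoning

-- Coefficients of products of linear forms

ifPositive : ℕ → ℤ → ℤ
ifPositive zero    _ = 0ℤ
ifPositive (suc _) r = r

ifPositive-0ℤ : ∀ n → ifPositive n 0ℤ ≡ 0ℤ
ifPositive-0ℤ zero    = refl
ifPositive-0ℤ (suc _) = refl

ifPositive-comm : ∀ m n r → ifPositive m (ifPositive n r) ≡ ifPositive n (ifPositive m r)
ifPositive-comm zero    zero    r = refl
ifPositive-comm zero    (suc _) r = refl
ifPositive-comm (suc _) zero    r = refl
ifPositive-comm (suc _) (suc _) r = refl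

ifPositive-distrib-sub : ∀ n r s → ifPositive n (r - s) ≡ ifPositive n r - ifPositive n s
ifPositive-distrib-sub zero    r s = refl
ifPositive-distrib-sub (suc _) r s = refl

module _ {n : ℕ} where

  Factors : Set
  Factors = List (Fin n × Fin n)

  lower-self : (e : Monomial n) (x : Fin n) → lower e x x ≡ e x ∸ 1
  lower-self e x with x Fin.≟ x
  ... | yes _   = refl
  ... | no x≢x = ⊥-elim (x≢x refl)

  lower-other : (e : Monomial n) (x y : Fin n) → y ≢ x → lower e x y ≡ e y
  lower-other e x y y≢x with y Fin.≟ x
  ... | yes y≡x = ⊥-elim (y≢x y≡x)
  ... | no _    = refl

  lower-cong : {e e′ : Monomial n} (x : Fin n) → e ≗ e′ → lower e x ≗ lower e′ x
  lower-cong x e≗e′ y = cong (λ m → if does (y Fin.≟ x) then m ∸ 1 else m) (e≗e′ y)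

  lower-comm : (e : Monomial n) (x y : Fin n) → lower (lower e x) y ≗ lower (lower e y) x
  lower-comm e x y z with z Fin.≟ x | z Fin.≟ y
  ... | yes _ | yes _ = refl
  ... | yes _ | no _  = refl
  ... | no _  | yes _ = refl
  ... | no _  | no _  = refl

  -- the coefficient collected when the first factor contributes the variable x
  choose : Factors → Monomial n → Fin n → ℤ
  choose es e x = ifPositive (e x) (coeffProd es (lower e x))

  coeffProd-∷ : (a b : Fin n) (es : Factors) (e : Monomial n) →
                coeffProd ((a , b) ∷ es) e ≡ choose es e a - choose es e b
  coeffProd-∷ a b es e with e a | e b
  ... | zero  | zero  = refl
  ... | zero  | suc _ = refl
  ... | suc _ | zero  = refl
  ... | suc _ | suc _ = refl

  degree-cong : {e e′ : Monomial n} → e ≗ e′ → degree e ≡ degree e′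
  degree-cong e≗e′ = cong sum (Listₚ.map-cong e≗e′ (allFin n))

  coeffProd-cong : (es : Factors) {e e′ : Monomial n} → e ≗ e′ → coeffProd es e ≡ coeffProd es e′
  coeffProd-cong []             e≗e′ = cong (λ d → if does (d ℕ.≟ 0) then 1ℤ else 0ℤ) (degree-cong e≗e′)
  coeffProd-cong ((a , b) ∷ es) {e} {e′} e≗e′ = begin
    coeffProd ((a , b) ∷ es) e   ≡⟨ coeffProd-∷ a b es e ⟩
    choose es e a - choose es e b    ≡⟨ cong₂ _-_ (choose-cong a) (choose-cong b) ⟩
    choose es e′ a - choose es e′ b  ≡⟨ coeffProd-∷ a b es e′ ⟨
    coeffProd ((a , b) ∷ es) e′  ∎
    where
    choose-cong : ∀ x → choose es e x ≡ choose es e′ x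
    choose-cong x = cong₂ ifPositive (e≗e′ x) (coeffProd-cong es (lower-cong x e≗e′))

  coeffProd-∷-lower : (a b : Fin n) (es : Factors) (e : Monomial n) {eᵃ eᵇ : Monomial n} →
                      lower e a ≗ eᵃ → lower e b ≗ eᵇ →
                      coeffProd ((a , b) ∷ es) e ≡ ifPositive (e a) (coeffProd es eᵃ) - ifPositive (e b) (coeffProd es eᵇ)
  coeffProd-∷-lower a b es e eᵃ eᵇ =
    trans (coeffProd-∷ a b es e)
          (cong₂ (λ r s → ifPositive (e a) r - ifPositive (e b) s) (coeffProd-cong es eᵃ) (coeffProd-cong es eᵇ))

  choose₂ : Factors → Monomial n → Fin n → Fin n → ℤ
  choose₂ es e x y = ifPositive (e x) (choose es (lower e x) y)

  coeffProd-∷∷ : (a b c d : Fin n) (es : Factors) (e : Monomial n) →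
    coeffProd ((a , b) ∷ (c , d) ∷ es) e
      ≡ (choose₂ es e a c - choose₂ es e a d) - (choose₂ es e b c - choose₂ es e b d)
  coeffProd-∷∷ a b c d es e =
    trans (coeffProd-∷ a b ((c , d) ∷ es) e) (cong₂ _-_ (expand a) (expand b))
    where
    expand : ∀ x → choose ((c , d) ∷ es) e x ≡ choose₂ es e x c - choose₂ es e x d
    expand x = trans (cong (ifPositive (e x)) (coeffProd-∷ c d es (lower e x)))
                     (ifPositive-distrib-sub (e x) _ _)

  choose₂-comm : (es : Factors) (e : Monomial n) (x y : Fin n) → choose₂ es e x y ≡ choose₂ es e y x
  choose₂-comm es e x y = by-cases (x Fin.≟ y)
    where
    by-cases : Dec (x ≡ y) → choose₂ es e x y ≡ choose₂ es e y x
    by-cases (yes x≡y) = subst (λ z → choose₂ es e x z ≡ choose₂ es e z x) x≡y refl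
    by-cases (no x≢y)  = begin
      ifPositive (e x) (ifPositive (lower e x y) (coeffProd es (lower (lower e x) y)))
        ≡⟨ cong₂ (λ m r → ifPositive (e x) (ifPositive m r))
                 (lower-other e x y (x≢y ∘ sym)) (coeffProd-cong es (lower-comm e x y)) ⟩
      ifPositive (e x) (ifPositive (e y) (coeffProd es (lower (lower e y) x)))
        ≡⟨ ifPositive-comm (e x) (e y) _ ⟩
      ifPositive (e y) (ifPositive (e x) (coeffProd es (lower (lower e y) x)))
        ≡⟨ cong (λ m → ifPositive (e y) (ifPositive m (coeffProd es (lower (lower e y) x))))
                (lower-other e y x x≢y) ⟨
      ifPositive (e y) (ifPositive (lower e y x) (coeffProd es (lower (lower e y) x)))  ∎

  coeffProd-swap : (a b c d : Fin n) (es : Factors) (e : Monomial n) →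
    coeffProd ((a , b) ∷ (c , d) ∷ es) e ≡ coeffProd ((c , d) ∷ (a , b) ∷ es) e
  coeffProd-swap a b c d es e = begin
    coeffProd ((a , b) ∷ (c , d) ∷ es) e         ≡⟨ coeffProd-∷∷ a b c d es e ⟩
    (T a c - T a d) - (T b c - T b d)            ≡⟨ cong₂ _-_ (cong₂ _-_ (comm a c) (comm a d))
                                                              (cong₂ _-_ (comm b c) (comm b d)) ⟩
    (T c a - T d a) - (T c b - T d b)            ≡⟨ interchange (T c a) (T d a) (T c b) (T d b) ⟩
    (T c a - T c b) - (T d a - T d b)            ≡⟨ coeffProd-∷∷ c d a b es e ⟨
    coeffProd ((c , d) ∷ (a , b) ∷ es) e         ∎
    where
    T = choose₂ es e
    comm = choose₂-comm es e
    interchange : ∀ p q r s → (p - q) - (r - s) ≡ (p - r) - (q - s)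
    interchange = solve-∀

  coeffProd-∷⁺ : ∀ p {es es′ : Factors} → coeffProd es ≗ coeffProd es′ →
                 coeffProd (p ∷ es) ≗ coeffProd (p ∷ es′)
  coeffProd-∷⁺ (a , b) {es} {es′} eq e = begin
    coeffProd ((a , b) ∷ es) e     ≡⟨ coeffProd-∷ a b es e ⟩
    choose es e a - choose es e b    ≡⟨ cong₂ (λ r s → ifPositive (e a) r - ifPositive (e b) s)
                                              (eq (lower e a)) (eq (lower e b)) ⟩
    choose es′ e a - choose es′ e b  ≡⟨ coeffProd-∷ a b es′ e ⟨
    coeffProd ((a , b) ∷ es′) e    ∎

  coeffProd-↭ : {es es′ : Factors} → es ↭ es′ → coeffProd es ≗ coeffProd es′
  coeffProd-↭ ↭.refl         e = refl
  coeffProd-↭ (↭.prep p r)   e = coeffProd-∷⁺ p (coeffProd-↭ r) e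
  coeffProd-↭ (↭.swap p q r) e =
    trans (coeffProd-swap _ _ _ _ _ e) (coeffProd-∷⁺ q (coeffProd-∷⁺ p (coeffProd-↭ r)) e)
  coeffProd-↭ (↭.trans r r′) e = trans (coeffProd-↭ r e) (coeffProd-↭ r′ e)

  ≤-sum-map : (e : Monomial n) {x : Fin n} {xs : List (Fin n)} → x ∈ xs → e x ≤ sum (map e xs)
  ≤-sum-map e (here refl)  = ℕₚ.m≤m+n _ _
  ≤-sum-map e {xs = y ∷ _} (there x∈xs) = ℕₚ.m≤n⇒m≤o+n (e y) (≤-sum-map e x∈xs)

  sum-map-≡0 : (e : Monomial n) → (∀ x → e x ≡ 0) → (xs : List (Fin n)) → sum (map e xs) ≡ 0
  sum-map-≡0 e e≡0 []       = refl
  sum-map-≡0 e e≡0 (x ∷ xs) = cong₂ ℕ._+_ (e≡0 x) (sum-map-≡0 e e≡0 xs)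

  coeffProd-[]-one : (e : Monomial n) → (∀ x → e x ≡ 0) → coeffProd [] e ≡ 1ℤ
  coeffProd-[]-one e e≡0 =
    cong (λ d → if does (d ℕ.≟ 0) then 1ℤ else 0ℤ) (sum-map-≡0 e e≡0 (allFin n))

  coeffProd-[]-zero : (e : Monomial n) {z : Fin n} {c : ℕ} → e z ≡ suc c → coeffProd [] e ≡ 0ℤ
  coeffProd-[]-zero e {z} ez≡1+c = cong (λ b → if b then 1ℤ else 0ℤ) (dec-false (degree e ℕ.≟ 0) degree≢0)
    where
    degree≢0 : degree e ≢ 0
    degree≢0 degree≡0 =
      ℕₚ.1+n≢0 (ℕₚ.n≤0⇒n≡0 (subst₂ _≤_ ez≡1+c degree≡0 (≤-sum-map e (∈-allFin z))))

  Avoids : Fin n → Fin n × Fin n → Set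
  Avoids z (a , b) = a ≢ z × b ≢ z

  coeffProd-absent : {z : Fin n} {c : ℕ} (es : Factors) (e : Monomial n) →
                     All (Avoids z) es → e z ≡ suc c → coeffProd es e ≡ 0ℤ
  coeffProd-absent []             e []                    ez = coeffProd-[]-zero e ez
  coeffProd-absent {z} ((a , b) ∷ es) e ((a≢z , b≢z) ∷ avoid) ez = begin
    coeffProd ((a , b) ∷ es) e       ≡⟨ coeffProd-∷ a b es e ⟩
    choose es e a - choose es e b    ≡⟨ cong₂ _-_ (vanish a a≢z) (vanish b b≢z) ⟩
    0ℤ                               ∎
    where
    vanish : ∀ x → x ≢ z → choose es e x ≡ 0ℤ
    vanish x x≢z = trans
      (cong (ifPositive (e x)) (coeffProd-absent es (lower e x) avoid (trans (lower-other e x z (x≢z ∘ sym)) ez)))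
      (ifPositive-0ℤ (e x))

-- The fan and its edge list

clamp : (n : ℕ) → ℕ → Fin (suc n)
clamp n       zero    = zero
clamp zero    (suc _) = zero
clamp (suc n) (suc m) = suc (clamp n m)

clamp-toℕ : ∀ {n} (x : Fin (suc n)) → clamp n (toℕ x) ≡ x
clamp-toℕ         zero    = refl
clamp-toℕ {suc n} (suc x) = cong suc (clamp-toℕ x)

toℕ-clamp : ∀ {n m} → m ≤ n → toℕ (clamp n m) ≡ m
toℕ-clamp {m = zero}          _         = refl
toℕ-clamp {suc n} {suc m} (s≤s m≤n) = cong suc (toℕ-clamp m≤n)

clamp-< : ∀ {n i j} → i < j → j ≤ n → clamp n i ≢ clamp n j
clamp-< i<j j≤n eq = ℕₚ.<⇒≢ i<j (begin
  _                  ≡⟨ toℕ-clamp (ℕₚ.<⇒≤ (ℕₚ.<-≤-trans i<j j≤n)) ⟨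
  toℕ (clamp _ _)    ≡⟨ cong toℕ eq ⟩
  toℕ (clamp _ _)    ≡⟨ toℕ-clamp j≤n ⟩
  _                  ∎)

tabulate-applyUpTo : ∀ {a} {A : Set a} {n} {f : Fin n → A} {g : ℕ → A} → (∀ x → f x ≡ g (toℕ x)) →
                     tabulate f ≡ applyUpTo g n
tabulate-applyUpTo {n = zero}  f≡g = refl
tabulate-applyUpTo {n = suc n} f≡g = cong₂ _∷_ (f≡g zero) (tabulate-applyUpTo (f≡g ∘ suc))

module _ {a} {A : Set a} where

  applyUpTo-cong : {f g : ℕ → A} → f ≗ g → ∀ n → applyUpTo f n ≡ applyUpTo g n
  applyUpTo-cong f≗g zero    = refl
  applyUpTo-cong f≗g (suc n) = cong₂ _∷_ (f≗g 0) (applyUpTo-cong (f≗g ∘ suc) n)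

  concatMap-allFin : ∀ {n} {f : Fin n → List A} {g : ℕ → List A} → (∀ x → f x ≡ g (toℕ x)) →
                     concatMap f (allFin n) ≡ concat (applyUpTo g n)
  concatMap-allFin {f = f} f≡g = cong concat (trans (Listₚ.map-tabulate (λ x → x) f) (tabulate-applyUpTo f≡g))

  concat-applyUpTo-[] : ∀ n → concat (applyUpTo (λ _ → [] {A = A}) n) ≡ []
  concat-applyUpTo-[] zero    = refl
  concat-applyUpTo-[] (suc n) = concat-applyUpTo-[] n

  concat-applyUpTo-[-] : ∀ (f : ℕ → A) n → concat (applyUpTo (λ i → f i ∷ []) n) ≡ applyUpTo f n
  concat-applyUpTo-[-] f zero    = refl
  concat-applyUpTo-[-] f (suc n) = cong (f 0 ∷_) (concat-applyUpTo-[-] (f ∘ suc) n)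

  concat-applyUpTo-≟ : ∀ (f : ℕ → A) n c →
    concat (applyUpTo (λ i → if does (i ℕ.≟ c) then f i ∷ [] else []) n) ≡ (if does (c ℕ.<? n) then f c ∷ [] else [])
  concat-applyUpTo-≟ f zero    c       = refl
  concat-applyUpTo-≟ f (suc n) zero    = cong (f 0 ∷_) (concat-applyUpTo-[] n)
  concat-applyUpTo-≟ f (suc n) (suc c) = concat-applyUpTo-≟ (f ∘ suc) n c

  concat-applyUpTo-<? : ∀ (f : ℕ → A) {n m} → m ≤ n →
    concat (applyUpTo (λ i → if does (i ℕ.<? m) then f i ∷ [] else []) n) ≡ applyUpTo f m
  concat-applyUpTo-<? f {n}     {zero}  _         = concat-applyUpTo-[] n
  concat-applyUpTo-<? f {suc n} {suc m} (s≤s m≤n) = cong (f 0 ∷_) (concat-applyUpTo-<? (f ∘ suc) m≤n)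

  ∷ʳ-++-∷ʳ-↭ : ∀ (xs : List A) x ys y → (xs ∷ʳ x) ++ (ys ∷ʳ y) ↭ x ∷ y ∷ xs ++ ys
  ∷ʳ-++-∷ʳ-↭ xs x ys y = ↭.trans (↭ₚ.++⁺ (↭ₚ.++-comm xs (x ∷ [])) (↭ₚ.++-comm ys (y ∷ [])))
                                  (↭.prep x (↭ₚ.shift y xs ys))

≡does : ∀ {P : Set} {b : Bool} (P? : Dec P) → (b ≡ true ⇔ P) → b ≡ does P?
≡does {b = true}  P? b⇔P = sym (dec-true P? (Equivalence.to b⇔P refl))
≡does {b = false} P? b⇔P = sym (dec-false P? (λ p → case Equivalence.from b⇔P p of λ ()))

-- the index 0 stands for u and the index i ≥ 1 for vᵢ
fanAdj : ℕ → ℕ → Bool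
fanAdj zero    zero    = false
fanAdj zero    (suc _) = true
fanAdj (suc _) zero    = true
fanAdj (suc i) (suc j) = does ((j ℕ.≟ suc i) ⊎-dec (i ℕ.≟ suc j))

adj-fanAdj : ∀ {k} (G : Graph (suc k)) →
  (∀ (i : Fin k) → adj G zero (suc i) ≡ true) →
  (∀ (i j : Fin k) → (adj G (suc i) (suc j) ≡ true) ⇔ (toℕ j ≡ suc (toℕ i) ⊎ toℕ i ≡ suc (toℕ j))) →
  ∀ x y → adj G x y ≡ fanAdj (toℕ x) (toℕ y)
adj-fanAdj G spokes rims zero    zero    = irref G zero
adj-fanAdj G spokes rims zero    (suc j) = spokes j
adj-fanAdj G spokes rims (suc i) zero    = trans (Graph.sym G (suc i) zero) (spokes i)
adj-fanAdj G spokes rims (suc i) (suc j) = ≡does ((toℕ j ℕ.≟ suc (toℕ i)) ⊎-dec (toℕ i ℕ.≟ suc (toℕ j))) (rims i j)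

module Fan (k : ℕ) where

  v : ℕ → Fin (suc k)
  v = clamp k

  spoke rim : ℕ → Fin (suc k) × Fin (suc k)
  spoke i = (v 0 , v (suc i))
  rim   i = (v (suc i) , v (suc (suc i)))

  -- the factors of the fan on u, v₁, …, v_{m+1}, those at the newest vertex first
  factors : ℕ → List (Fin (suc k) × Fin (suc k))
  factors zero    = spoke 0 ∷ []
  factors (suc m) = spoke (suc m) ∷ rim m ∷ factors m

  factors-↭ : ∀ m → applyUpTo spoke (suc m) ++ applyUpTo rim m ↭ factors m
  factors-↭ zero    = ↭.refl
  factors-↭ (suc m) = ↭.trans
    (↭.↭-reflexive (sym (cong₂ _++_ (Listₚ.applyUpTo-∷ʳ spoke (suc m)) (Listₚ.applyUpTo-∷ʳ rim m))))
    (↭.trans (∷ʳ-++-∷ʳ-↭ (applyUpTo spoke (suc m)) (spoke (suc m)) (applyUpTo rim m) (rim m))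
             (↭.prep _ (↭.prep _ (factors-↭ m))))

  fanRow : ℕ → ℕ → List (Fin (suc k) × Fin (suc k))
  fanRow a b = if does (a ℕ.<? b) then (if fanAdj a b then (v a , v b) ∷ [] else []) else []

  edges-fanRow : (G : Graph (suc k)) → (∀ x y → adj G x y ≡ fanAdj (toℕ x) (toℕ y)) →
                 edges G ≡ concat (applyUpTo (λ a → concat (applyUpTo (fanRow a) (suc k))) (suc k))
  edges-fanRow G adj≡ =
    concatMap-allFin {g = λ a → concat (applyUpTo (fanRow a) (suc k))}
                     (λ x → concatMap-allFin {g = fanRow (toℕ x)} (row≡ x))
    where
    row≡ : ∀ x y → (if does (toℕ x ℕ.<? toℕ y) then (if adj G x y then (x , y) ∷ [] else []) else [])
                   ≡ fanRow (toℕ x) (toℕ y)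
    row≡ x y = cong₂ (λ b p → if does (toℕ x ℕ.<? toℕ y) then (if b then p ∷ [] else []) else [])
                     (adj≡ x y) (sym (cong₂ _,_ (clamp-toℕ x) (clamp-toℕ y)))

  fanRow-rim : ∀ a b → fanRow (suc a) (suc b) ≡ (if does (b ℕ.≟ suc a) then (v (suc a) , v (suc b)) ∷ [] else [])
  fanRow-rim a b = select (a ℕ.<? b) (b ℕ.≟ suc a) (a ℕ.≟ suc b)
    where
    L = (v (suc a) , v (suc b)) ∷ []
    select : (a<b? : Dec (a < b)) (b≡1+a? : Dec (b ≡ suc a)) (a≡1+b? : Dec (a ≡ suc b)) →
             (if does a<b? then (if does (b≡1+a? ⊎-dec a≡1+b?) then L else []) else [])
             ≡ (if does b≡1+a? then L else [])
    select (yes _)   (yes _)      _            = refl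
    select (no a≮b)  (yes b≡1+a)  _            = ⊥-elim (a≮b (subst (a <_) (sym b≡1+a) (ℕₚ.n<1+n a)))
    select (yes a<b) (no _)       (yes a≡1+b)  = ⊥-elim (ℕₚ.<-asym a<b (subst (b <_) (sym a≡1+b) (ℕₚ.n<1+n b)))
    select (no _)    (no _)       (yes _)      = refl
    select (yes _)   (no _)       (no _)       = refl
    select (no _)    (no _)       (no _)       = refl

  fanRow-spokes : concat (applyUpTo (fanRow 0) (suc k)) ≡ applyUpTo spoke k
  fanRow-spokes = concat-applyUpTo-[-] spoke k

  fanRow-rims : ∀ a → concat (applyUpTo (fanRow (suc a)) (suc k)) ≡ (if does (suc a ℕ.<? k) then rim a ∷ [] else [])
  fanRow-rims a = trans (cong concat (applyUpTo-cong (fanRow-rim a) k))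
                        (concat-applyUpTo-≟ (λ b → (v (suc a) , v (suc b))) k (suc a))

fan-edges : ∀ K (G : Graph (suc (suc K))) → (∀ x y → adj G x y ≡ fanAdj (toℕ x) (toℕ y)) →
            edges G ↭ Fan.factors (suc K) K
fan-edges K G adj≡ = ↭.trans (↭.↭-reflexive edges≡) (factors-↭ K)
  where
  open Fan (suc K)
  edges≡ : edges G ≡ applyUpTo spoke (suc K) ++ applyUpTo rim K
  edges≡ = begin
    edges G
      ≡⟨ edges-fanRow G adj≡ ⟩
    concat (applyUpTo (λ a → concat (applyUpTo (fanRow a) (suc (suc K)))) (suc (suc K)))
      ≡⟨ cong₂ _++_ fanRow-spokes (cong concat (applyUpTo-cong fanRow-rims (suc K))) ⟩
    applyUpTo spoke (suc K) ++ concat (applyUpTo (λ a → if does (a ℕ.<? K) then rim a ∷ [] else []) (suc K))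
      ≡⟨ cong (applyUpTo spoke (suc K) ++_) (concat-applyUpTo-<? rim (ℕₚ.n≤1+n K)) ⟩
    applyUpTo spoke (suc K) ++ applyUpTo rim K
      ∎

-- The coefficient recursion

prefix : (ℕ → ℕ) → ℕ → ℕ → ℕ → ℕ
prefix f zero    c zero    = c
prefix f zero    c (suc _) = 0
prefix f (suc m) c zero    = f 0
prefix f (suc m) c (suc i) = prefix (f ∘ suc) m c i

prefix-< : ∀ f {m} c {i} → i < m → prefix f m c i ≡ f i
prefix-< f {suc m} c {zero}  _         = refl
prefix-< f {suc m} c {suc i} (s≤s i<m) = prefix-< (f ∘ suc) c i<m

prefix-self : ∀ f m c → prefix f m c m ≡ c
prefix-self f zero    c = refl
prefix-self f (suc m) c = prefix-self (f ∘ suc) m c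

prefix-other : ∀ f {m} c c′ {i} → i ≢ m → prefix f m c i ≡ prefix f m c′ i
prefix-other f {zero}  c c′ {zero}  i≢m = ⊥-elim (i≢m refl)
prefix-other f {zero}  c c′ {suc i} _   = refl
prefix-other f {suc m} c c′ {zero}  _   = refl
prefix-other f {suc m} c c′ {suc i} i≢m = prefix-other (f ∘ suc) c c′ (i≢m ∘ cong suc)

prefix-suc-0 : ∀ f m i → prefix f (suc m) 0 i ≡ prefix f m (f m) i
prefix-suc-0 f zero    zero          = refl
prefix-suc-0 f zero    (suc zero)    = refl
prefix-suc-0 f zero    (suc (suc i)) = refl
prefix-suc-0 f (suc m) zero          = refl
prefix-suc-0 f (suc m) (suc i)       = prefix-suc-0 (f ∘ suc) m i

-- the exponents of v₁, v₂, v₃, … in the target monomial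
pathExp : ℕ → ℕ
pathExp 0             = 1
pathExp 1             = 1
pathExp (suc (suc _)) = 2

ifPositive-pathExp : ∀ i r → ifPositive (pathExp i) r ≡ r
ifPositive-pathExp 0             r = refl
ifPositive-pathExp 1             r = refl
ifPositive-pathExp (suc (suc _)) r = refl

-- the exponent of vertex j in u^a v₁^{pathExp 0} ⋯ v_m^{pathExp (m-1)} v_{m+1}^c
stageExp : ℕ → ℕ → ℕ → ℕ → ℕ
stageExp m a c zero    = a
stageExp m a c (suc i) = prefix pathExp m c i

stageExp-suc-0 : ∀ m a j → stageExp (suc m) a 0 j ≡ stageExp m a (pathExp m) j
stageExp-suc-0 m a zero    = refl
stageExp-suc-0 m a (suc i) = prefix-suc-0 pathExp m i

stageExp-other : ∀ m a c c′ {j} → j ≢ suc m → stageExp m a c j ≡ stageExp m a c′ j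
stageExp-other m a c c′ {zero}  _   = refl
stageExp-other m a c c′ {suc i} j≢m = prefix-other pathExp c c′ (j≢m ∘ cong suc)

stageExp-0-0-0 : ∀ j → stageExp 0 0 0 j ≡ 0
stageExp-0-0-0 zero          = refl
stageExp-0-0-0 (suc zero)    = refl
stageExp-0-0-0 (suc (suc _)) = refl

module Stages (k : ℕ) where

  open Fan k

  stage : ℕ → ℕ → ℕ → Monomial (suc k)
  stage m a c x = stageExp m a c (toℕ x)

  stageCoeff : ℕ → ℕ → ℕ → ℤ
  stageCoeff m a c = coeffProd (factors m) (stage m a c)

  rimCoeff : ℕ → ℕ → ℕ → ℤ
  rimCoeff m a c = coeffProd (rim m ∷ factors m) (stage (suc m) a c)

  stage-v : ∀ {j} m a c → j ≤ k → stage m a c (v j) ≡ stageExp m a c j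
  stage-v m a c j≤k = cong (stageExp m a c) (toℕ-clamp j≤k)

  stage-last : ∀ {m} a c → suc m ≤ k → stage m a c (v (suc m)) ≡ c
  stage-last {m} a c le = trans (stage-v m a c le) (prefix-self pathExp m c)

  stage-previous : ∀ {m} a c → suc (suc m) ≤ k → stage (suc m) a c (v (suc m)) ≡ pathExp m
  stage-previous {m} a c le =
    trans (stage-v (suc m) a c (ℕₚ.<⇒≤ le)) (prefix-< pathExp c (ℕₚ.n<1+n m))

  stage-suc-0 : ∀ m a → stage (suc m) a 0 ≗ stage m a (pathExp m)
  stage-suc-0 m a x = stageExp-suc-0 m a (toℕ x)

  lower-stage-u : ∀ m a c → lower (stage m a c) (v 0) ≗ stage m (a ∸ 1) c
  lower-stage-u m a c zero    = refl
  lower-stage-u m a c (suc _) = refl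

  lower-stage-last : ∀ {m} a c → suc m ≤ k → lower (stage m a c) (v (suc m)) ≗ stage m a (c ∸ 1)
  lower-stage-last {m} a c le x = by-cases x (x Fin.≟ v (suc m))
    where
    by-cases : ∀ y → Dec (y ≡ v (suc m)) → lower (stage m a c) (v (suc m)) y ≡ stage m a (c ∸ 1) y
    by-cases y (yes refl) = begin
      lower (stage m a c) (v (suc m)) (v (suc m))  ≡⟨ lower-self (stage m a c) (v (suc m)) ⟩
      stage m a c (v (suc m)) ∸ 1                  ≡⟨ cong (_∸ 1) (stage-last a c le) ⟩
      c ∸ 1                                        ≡⟨ stage-last a (c ∸ 1) le ⟨
      stage m a (c ∸ 1) (v (suc m))                ∎
    by-cases y (no y≢v) = trans (lower-other (stage m a c) (v (suc m)) y y≢v)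
      (stageExp-other m a c (c ∸ 1) (λ toℕy≡1+m → y≢v (trans (sym (clamp-toℕ y)) (cong v toℕy≡1+m))))

  factors-avoid : ∀ m {j} → suc m < j → j ≤ k → All (Avoids (v j)) (factors m)
  factors-avoid zero    1<j j≤k = (clamp-< (ℕₚ.<-trans (s≤s z≤n) 1<j) j≤k , clamp-< 1<j j≤k) ∷ []
  factors-avoid (suc m) m+2<j j≤k =
      (clamp-< 0<j j≤k , clamp-< m+2<j j≤k)
    ∷ (clamp-< m+1<j j≤k , clamp-< m+2<j j≤k)
    ∷ factors-avoid m m+1<j j≤k
    where
    m+1<j = ℕₚ.<-trans (ℕₚ.n<1+n (suc m)) m+2<j
    0<j   = ℕₚ.≤-trans (s≤s z≤n) m+2<j

  factors-absent : ∀ m (e : Monomial (suc k)) {c} → suc (suc m) ≤ k →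
                   e (v (suc (suc m))) ≡ suc c → coeffProd (factors m) e ≡ 0ℤ
  factors-absent m e le = coeffProd-absent (factors m) e (factors-avoid m ℕₚ.≤-refl le)

  module _ {m : ℕ} (le : suc (suc m) ≤ k) where

    private
      le′ : suc m ≤ k
      le′ = ℕₚ.<⇒≤ le

      v≢v′ : v (suc (suc m)) ≢ v (suc m)
      v≢v′ = clamp-< (ℕₚ.n<1+n (suc m)) le ∘ sym

      -- taking v_{m+1} from the rim factor leaves v_{m+2} with its full exponent
      absent-after-v′ : ∀ a c → coeffProd (factors m) (lower (stage (suc m) a (suc c)) (v (suc m))) ≡ 0ℤ
      absent-after-v′ a c = factors-absent m (lower e (v (suc m))) le
        (trans (lower-other e (v (suc m)) (v (suc (suc m))) v≢v′) (stage-last a (suc c) le))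
        where e = stage (suc m) a (suc c)

    stageCoeff-suc : ∀ a c → stageCoeff (suc m) a c ≡ ifPositive a (rimCoeff m (a ∸ 1) c) - ifPositive c (rimCoeff m a (c ∸ 1))
    stageCoeff-suc a c = trans
      (coeffProd-∷-lower (v 0) (v (suc (suc m))) (rim m ∷ factors m) (stage (suc m) a c)
                         (lower-stage-u (suc m) a c) (lower-stage-last a c le))
      (cong (λ p → ifPositive a (rimCoeff m (a ∸ 1) c) - ifPositive p (rimCoeff m a (c ∸ 1))) (stage-last a c le))

    rimCoeff-0 : ∀ a → rimCoeff m a 0 ≡ stageCoeff m a (pathExp m ∸ 1)
    rimCoeff-0 a = begin
      rimCoeff m a 0
        ≡⟨ coeffProd-∷-lower (v (suc m)) (v (suc (suc m))) (factors m) e lower-v′ (λ _ → refl) ⟩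
      ifPositive (e (v (suc m))) X - ifPositive (e (v (suc (suc m)))) (coeffProd (factors m) (lower e (v (suc (suc m)))))
        ≡⟨ cong₂ (λ p q → ifPositive p X - ifPositive q (coeffProd (factors m) (lower e (v (suc (suc m))))))
                 (stage-previous a 0 le) (stage-last a 0 le) ⟩
      ifPositive (pathExp m) X - 0ℤ
        ≡⟨ ℤₚ.+-identityʳ _ ⟩
      ifPositive (pathExp m) X
        ≡⟨ ifPositive-pathExp m X ⟩
      X ∎
      where
      e = stage (suc m) a 0
      X = stageCoeff m a (pathExp m ∸ 1)
      lower-v′ : lower e (v (suc m)) ≗ stage m a (pathExp m ∸ 1)
      lower-v′ x = trans (lower-cong (v (suc m)) (stage-suc-0 m a) x) (lower-stage-last a (pathExp m) le′ x)

    rimCoeff-1 : ∀ a → rimCoeff m a 1 ≡ - stageCoeff m a (pathExp m)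
    rimCoeff-1 a = begin
      rimCoeff m a 1
        ≡⟨ coeffProd-∷-lower (v (suc m)) (v (suc (suc m))) (factors m) e (λ _ → refl) lower-v ⟩
      ifPositive (e (v (suc m))) (coeffProd (factors m) (lower e (v (suc m)))) - ifPositive (e (v (suc (suc m)))) X
        ≡⟨ cong₂ (λ r p → ifPositive (e (v (suc m))) r - ifPositive p X) (absent-after-v′ a 0) (stage-last a 1 le) ⟩
      ifPositive (e (v (suc m))) 0ℤ - X
        ≡⟨ cong (_- X) (ifPositive-0ℤ (e (v (suc m)))) ⟩
      0ℤ - X
        ≡⟨ ℤₚ.+-identityˡ (- X) ⟩
      - X ∎
      where
      e = stage (suc m) a 1
      X = stageCoeff m a (pathExp m)
      lower-v : lower e (v (suc (suc m))) ≗ stage m a (pathExp m)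
      lower-v x = trans (lower-stage-last a 1 le x) (stage-suc-0 m a x)

    rimCoeff-2 : ∀ a → rimCoeff m a 2 ≡ 0ℤ
    rimCoeff-2 a = begin
      rimCoeff m a 2
        ≡⟨ coeffProd-∷-lower (v (suc m)) (v (suc (suc m))) (factors m) e (λ _ → refl) (lower-stage-last a 2 le) ⟩
      ifPositive (e (v (suc m))) (coeffProd (factors m) (lower e (v (suc m))))
        - ifPositive (e (v (suc (suc m)))) (coeffProd (factors m) (stage (suc m) a 1))
        ≡⟨ cong₂ (λ r s → ifPositive (e (v (suc m))) r - ifPositive (e (v (suc (suc m)))) s)
                 (absent-after-v′ a 1) (factors-absent m _ le (stage-last a 1 le)) ⟩
      ifPositive (e (v (suc m))) 0ℤ - ifPositive (e (v (suc (suc m)))) 0ℤ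
        ≡⟨ cong₂ _-_ (ifPositive-0ℤ (e (v (suc m)))) (ifPositive-0ℤ (e (v (suc (suc m))))) ⟩
      0ℤ ∎
      where
      e = stage (suc m) a 2

    stageCoeff-suc-0 : ∀ a → stageCoeff (suc m) (suc a) 0 ≡ stageCoeff m a (pathExp m ∸ 1)
    stageCoeff-suc-0 a = begin
      stageCoeff (suc m) (suc a) 0  ≡⟨ stageCoeff-suc (suc a) 0 ⟩
      rimCoeff m a 0 - 0ℤ           ≡⟨ ℤₚ.+-identityʳ _ ⟩
      rimCoeff m a 0                ≡⟨ rimCoeff-0 a ⟩
      stageCoeff m a (pathExp m ∸ 1) ∎

    stageCoeff-suc-1 : ∀ a → stageCoeff (suc m) (suc a) 1 ≡ - stageCoeff m a (pathExp m) - stageCoeff m (suc a) (pathExp m ∸ 1)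
    stageCoeff-suc-1 a = trans (stageCoeff-suc (suc a) 1) (cong₂ _-_ (rimCoeff-1 a) (rimCoeff-0 (suc a)))

    stageCoeff-suc-2 : ∀ a → stageCoeff (suc m) a 2 ≡ stageCoeff m a (pathExp m)
    stageCoeff-suc-2 a = begin
      stageCoeff (suc m) a 2                              ≡⟨ stageCoeff-suc a 2 ⟩
      ifPositive a (rimCoeff m (a ∸ 1) 2) - rimCoeff m a 1  ≡⟨ cong₂ _-_ (cong (ifPositive a) (rimCoeff-2 (a ∸ 1))) (rimCoeff-1 a) ⟩
      ifPositive a 0ℤ - - X                               ≡⟨ cong (_- - X) (ifPositive-0ℤ a) ⟩
      0ℤ - - X                                            ≡⟨ trans (ℤₚ.+-identityˡ (- - X)) (ℤₚ.neg-involutive X) ⟩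
      X                                                   ∎
      where
      X = stageCoeff m a (pathExp m)

  stageCoeff-0-1-0≡1 : 1 ≤ k → stageCoeff 0 1 0 ≡ 1ℤ
  stageCoeff-0-1-0≡1 le = begin
    stageCoeff 0 1 0
      ≡⟨ coeffProd-∷-lower (v 0) (v 1) [] e (lower-stage-u 0 1 0) (λ _ → refl) ⟩
    coeffProd [] (stage 0 0 0) - ifPositive (e (v 1)) (coeffProd [] (lower e (v 1)))
      ≡⟨ cong₂ (λ r p → r - ifPositive p (coeffProd [] (lower e (v 1))))
               (coeffProd-[]-one (stage 0 0 0) (stageExp-0-0-0 ∘ toℕ)) (stage-last 1 0 le) ⟩
    1ℤ ∎
    where e = stage 0 1 0

  stageCoeff-0-0-1≡-1 : 1 ≤ k → stageCoeff 0 0 1 ≡ -1ℤ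
  stageCoeff-0-0-1≡-1 le = begin
    stageCoeff 0 0 1
      ≡⟨ coeffProd-∷-lower (v 0) (v 1) [] e (λ _ → refl) (lower-stage-last 0 1 le) ⟩
    0ℤ - ifPositive (e (v 1)) (coeffProd [] (stage 0 0 0))
      ≡⟨ cong₂ (λ p r → 0ℤ - ifPositive p r) (stage-last 0 1 le) (coeffProd-[]-one (stage 0 0 0) (stageExp-0-0-0 ∘ toℕ)) ⟩
    -1ℤ ∎
    where e = stage 0 0 1

  stageCoeff-1-1-1≡0 : 2 ≤ k → stageCoeff 1 1 1 ≡ 0ℤ
  stageCoeff-1-1-1≡0 le = begin
    stageCoeff 1 1 1                          ≡⟨ stageCoeff-suc-1 le 0 ⟩
    - stageCoeff 0 0 1 - stageCoeff 0 1 0     ≡⟨ cong₂ (λ p q → - p - q) (stageCoeff-0-0-1≡-1 le′) (stageCoeff-0-1-0≡1 le′) ⟩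
    0ℤ                                        ∎
    where le′ = ℕₚ.<⇒≤ le

  stageCoeff-1-2≡0 : ∀ t → 3 ℕ.+ t ≤ k → stageCoeff (2 ℕ.+ t) 1 2 ≡ 0ℤ
  stageCoeff-1-2≡0 zero    le = trans (stageCoeff-suc-2 le 1) (stageCoeff-1-1-1≡0 (ℕₚ.<⇒≤ le))
  stageCoeff-1-2≡0 (suc t) le = trans (stageCoeff-suc-2 le 1) (stageCoeff-1-2≡0 t (ℕₚ.<⇒≤ le))

  ∣stageCoeff-2-1∣≡1 : ∀ t → 3 ℕ.+ t ≤ k → ℤ.∣ stageCoeff (2 ℕ.+ t) 2 1 ∣ ≡ 1
  ∣stageCoeff-2-1∣≡1 zero le = cong ℤ.∣_∣ (begin
    stageCoeff 2 2 1                          ≡⟨ stageCoeff-suc-1 le 1 ⟩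
    - stageCoeff 1 1 1 - stageCoeff 1 2 0     ≡⟨ cong₂ (λ p q → - p - q) (stageCoeff-1-1-1≡0 le′)
                                                         (trans (stageCoeff-suc-0 le′ 1) (stageCoeff-0-1-0≡1 (ℕₚ.<⇒≤ le′))) ⟩
    -1ℤ                                       ∎)
    where le′ = ℕₚ.<⇒≤ le
  ∣stageCoeff-2-1∣≡1 (suc t) le = begin
    ℤ.∣ stageCoeff (3 ℕ.+ t) 2 1 ∣                         ≡⟨ cong ℤ.∣_∣ (stageCoeff-suc-1 le 1) ⟩
    ℤ.∣ - stageCoeff (2 ℕ.+ t) 1 2 - X ∣                  ≡⟨ cong (λ p → ℤ.∣ - p - X ∣) (stageCoeff-1-2≡0 t le′) ⟩
    ℤ.∣ 0ℤ - X ∣                                          ≡⟨ cong ℤ.∣_∣ (ℤₚ.+-identityˡ (- X)) ⟩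
    ℤ.∣ - X ∣                                             ≡⟨ ℤₚ.∣-i∣≡∣i∣ X ⟩
    ℤ.∣ X ∣                                               ≡⟨ ∣stageCoeff-2-1∣≡1 t le′ ⟩
    1                                                     ∎
    where
    le′ = ℕₚ.<⇒≤ le
    X   = stageCoeff (2 ℕ.+ t) 2 1

vexp≡prefix : ∀ K i → i ≤ K → 2 ≤ K → vexp (suc K) i ≡ prefix pathExp K 0 i
vexp≡prefix K zero          _   2≤K = sym (prefix-< pathExp 0 (ℕₚ.<-trans (s≤s z≤n) 2≤K))
vexp≡prefix K (suc zero)    _   2≤K = sym (prefix-< pathExp 0 2≤K)
vexp≡prefix K (suc (suc j)) i≤K _   with ℕₚ.m≤n⇒m<n∨m≡n i≤K
... | inj₁ i<K  = trans (cong (λ b → if b then 0 else 2) (dec-false (3 ℕ.+ j ℕ.≟ suc K) (ℕₚ.<⇒≢ (s≤s i<K))))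
                        (sym (prefix-< pathExp 0 i<K))
... | inj₂ refl = trans (cong (λ b → if b then 0 else 2) (dec-true (suc K ℕ.≟ suc K) refl))
                        (sym (prefix-self pathExp K 0))

targetMonomial≗stage : ∀ K → 2 ≤ K → targetMonomial (suc K) ≗ Stages.stage (suc K) K 3 0
targetMonomial≗stage K 2≤K zero    = refl
targetMonomial≗stage K 2≤K (suc j) = vexp≡prefix K (toℕ j) (ℕₚ.≤-pred (Finₚ.toℕ<n j)) 2≤K

lemma4p5 : (k : ℕ) → 3 < k → (G : Graph (suc k))
    → (∀ (i : Fin k) → adj G zero (suc i) ≡ true)
    → (∀ (i j : Fin k) → (adj G (suc i) (suc j) ≡ true) ⇔ (toℕ j ≡ suc (toℕ i) ⊎ toℕ i ≡ suc (toℕ j)))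
    → coeffP G (targetMonomial k) ≢ 0ℤ
lemma4p5 k (s≤s (s≤s (s≤s (s≤s {n = t} _)))) G spokes rims coeffP≡0 = 0≢1 (begin
  0                                              ≡⟨ cong ℤ.∣_∣ coeffP≡0 ⟨
  ℤ.∣ coeffP G (targetMonomial k) ∣              ≡⟨ cong ℤ.∣_∣ (coeffProd-↭ (fan-edges K G (adj-fanAdj G spokes rims)) _) ⟩
  ℤ.∣ coeffProd (factors K) (targetMonomial k) ∣  ≡⟨ cong ℤ.∣_∣ (coeffProd-cong (factors K) (targetMonomial≗stage K (s≤s (s≤s z≤n)))) ⟩
  ℤ.∣ stageCoeff K 3 0 ∣                          ≡⟨ cong ℤ.∣_∣ (stageCoeff-suc-0 ℕₚ.≤-refl 2) ⟩
  ℤ.∣ stageCoeff (2 ℕ.+ t) 2 1 ∣                  ≡⟨ ∣stageCoeff-2-1∣≡1 t (ℕₚ.n≤1+n _) ⟩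
  1                                              ∎)
  where
  K = 3 ℕ.+ t
  open Fan k
  open Stages k
  0≢1 : 0 ≢ 1
  0≢1 ()
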